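{- Let $q$ be a prime power and $S\subseteq GF(q)^n$ a vector space over $GF(q)$ such that two distinct elements $i,j\in[n]$ are in series in $\mathrm{Matroid}(S)$. Let $S'=\{x/\{j\}: x\in S\}\subseteq GF(q)^{n-1}$ be the projection of $S$ obtained by dropping coordinate $j$. Then $\mathrm{mult}(S)$ is ideal if and only if $\mathrm{mult}(S')$ is ideal.
   Context: $\mathrm{Matroid}(S)$ is the matroid on $[n]$ represented over $GF(q)$ by any matrix $A$ with $S=\{x:Ax=\mathbf{0}\}$; its circuits are the inclusion-minimal sets among $\{\mathrm{support}(x):x\in S,x\neq\mathbf{0}\}$. Elements are in series in the usual matroid sense. $x/\{j\}$ denotes $x$ with coordinate $j$ removed. A clutter over $V$ is a family of subsets of $V$, no member containing another; it is ideal if every extreme point of $\{x\in\mathbb{R}^V:x\geq\mathbf{0},\ \sum_{v\in C}x_v\geq1\ \forall C\}$ is integral. For a vector space $S\subseteq GF(q)^n$, $\mathrm{mult}(S)$ is the clutter over $V_1\cup\cdots\cup V_n$ ($V_i$ disjoint copies of $GF(q)$) with members $\{x_1,\dots,x_n\}$ ($x_i$ in copy $V_i$) for $(x_1,\dots,x_n)\in S$.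
   Formalization: The polyhedron defining idealness of $\mathrm{mult}(S)$ and of $\mathrm{mult}(S')$ consists of points with rational coordinates rather than points of $\mathbb{R}^V$. -}

module Defs where

open import Level using (0ℓ)
open import Data.Nat as ℕ using (ℕ; suc; _^_)
open import Data.Nat.Primality using (Prime)
open import Data.Fin using (Fin)
open import Data.Fin.Subset using (Subset; _∈_; _⊆_; ⁅_⁆; _∪_)
open import Data.Vec using (Vec; lookup; map; zipWith; replicate; removeAt)
open import Data.Bool using (Bool; not)
open import Data.Product using (Σ; ∃; ∃-syntax; _×_)
open import Data.Integer using (ℤ)
open import Data.Rational as ℚ using (ℚ; _≤_; _+_; _*_; ½; 0ℚ; 1ℚ)
open import Relation.Nullary using (¬_; Dec; does)
open import Relation.Binary.PropositionalEquality using (_≡_; _≢_)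
open import Algebra.Structures using (IsCommutativeRing)
open import Function.Bundles using (_↔_)

IsPrimePower : ℕ → Set
IsPrimePower q = ∃[ p ] ∃[ k ] (Prime p × q ≡ p ^ suc k)

record FiniteField (q : ℕ) : Set₁ where
  infixl 7 _·_
  infixl 6 _⊕_
  field
    Carrier   : Set
    _⊕_ _·_   : Carrier → Carrier → Carrier
    ⊖_        : Carrier → Carrier
    𝟘 𝟙       : Carrier
    isCommutativeRing : IsCommutativeRing _≡_ _⊕_ _·_ ⊖_ 𝟘 𝟙
    𝟘≢𝟙       : 𝟘 ≢ 𝟙
    inverse   : ∀ a → a ≢ 𝟘 → ∃[ b ] (a · b ≡ 𝟙)
    _≟_       : (a b : Carrier) → Dec (a ≡ b)
    enumerate : Fin q ↔ Carrier

module _ {q : ℕ} (F : FiniteField q) where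
  open FiniteField F

  Vector : ℕ → Set
  Vector n = Vec Carrier n

  record IsSubspace {n : ℕ} (S : Vector n → Set) : Set where
    field
      zero∈  : S (replicate n 𝟘)
      +-closed : ∀ {x y} → S x → S y → S (zipWith _⊕_ x y)
      ·-closed : ∀ c {x} → S x → S (map (c ·_) x)

  IsZeroVec : ∀ {n} → Vector n → Set
  IsZeroVec {n} x = ∀ (i : Fin n) → lookup x i ≡ 𝟘

  support : ∀ {n} → Vector n → Subset n
  support x = map (λ a → not (does (a ≟ 𝟘))) x

  module _ {n : ℕ} (S : Vector n → Set) where

    IsSupport : Subset n → Set
    IsSupport C = ∃[ x ] (S x × ¬ IsZeroVec x × support x ≡ C)

    IsCircuit : Subset n → Set
    IsCircuit C = IsSupport C × (∀ D → IsSupport D → D ⊆ C → D ≡ C)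

    Independent : Subset n → Set
    Independent I = ∀ C → IsCircuit C → ¬ (C ⊆ I)

    IsBasis : Subset n → Set
    IsBasis B = Independent B × (∀ I → Independent I → B ⊆ I → I ≡ B)

    Meets : Subset n → Subset n → Set
    Meets D B = ∃[ i ] (i ∈ D × i ∈ B)

    MeetsAllBases : Subset n → Set
    MeetsAllBases D = ∀ B → IsBasis B → Meets D B

    IsCocircuit : Subset n → Set
    IsCocircuit D = MeetsAllBases D × (∀ D′ → MeetsAllBases D′ → D′ ⊆ D → D′ ≡ D)

    InSeries : Fin n → Fin n → Set
    InSeries i j = i ≢ j × IsCocircuit (⁅ i ⁆ ∪ ⁅ j ⁆)

  dropCoord : ∀ {m} → Fin (suc m) → (Vector (suc m) → Set) → Vector m → Set
  dropCoord j S y = ∃[ x ] (S x × removeAt x j ≡ y)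

  -- Idealness of mult(S).  Vertex set V₁ ∪ … ∪ Vₙ is Fin n × Carrier;
  -- a weight vector is w : Fin n → Carrier → ℚ.  The member of mult(S)
  -- for x ∈ S is {(i , xᵢ) : i ∈ [n]}.

  Weight : ℕ → Set
  Weight n = Fin n → Carrier → ℚ

  sumFin : ∀ {n} → (Fin n → ℚ) → ℚ
  sumFin {ℕ.zero} f = 0ℚ
  sumFin {suc n} f = f Fin.zero + sumFin (λ i → f (Fin.suc i))

  module _ {n : ℕ} (S : Vector n → Set) where

    InPolyhedron : Weight n → Set
    InPolyhedron w =
      (∀ i a → 0ℚ ≤ w i a) ×
      (∀ x → S x → 1ℚ ≤ sumFin (λ i → w i (lookup x i)))

    IsExtreme : Weight n → Set
    IsExtreme w = InPolyhedron w ×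
      (∀ u v → InPolyhedron u → InPolyhedron v →
         (∀ i a → w i a ≡ ½ * (u i a + v i a)) → ∀ i a → u i a ≡ v i a)

    IsIntegral : Weight n → Set
    IsIntegral w = ∀ i a → ∃[ k ] (w i a ≡ k ℚ./ 1)

    MultIdeal : Set
    MultIdeal = ∀ w → IsExtreme w → IsIntegral w

{-# OPTIONS --safe #-}
-- If i and j are in series, every x ∈ S satisfies x_j = c · x_i for one nonzero scalar c.
-- Otherwise some x ∈ S has x_i ≠ 0 = x_j; since {j} alone does not meet every basis, some
-- y ∈ S has y_j ≠ 0, and a maximal independent set avoiding i and j then spans i (through x)
-- and j (through y), so it is a basis disjoint from the cocircuit {i, j}.
--
-- Hence the member of mult(S) for x is the member of mult(S′) for x/{j} with the vertex
-- (j, c x_i) added beside (i, x_i). A weight for mult(S′) extends to mult(S) by zero on V_j,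
-- and a weight w for mult(S) collapses to mult(S′) by adding w(j, c a) onto w(i, a); both
-- maps respect the covering constraints. At an extreme point w one of w(i, a), w(j, c a) is
-- zero, for otherwise moving their minimum from one to the other, in either direction,
-- exhibits w as a midpoint. So extreme points correspond under these maps, and integrality
-- transfers both ways.
--
-- The matroid notions are classical, so that half of the argument runs in the
-- double-negation monad; this is harmless because being an integer is decidable in ℚ.

module Submission where

open import Defs
open import Level using (0ℓ)
open import Data.Nat as ℕ using (ℕ; suc; zero)
import Data.Nat.Properties as ℕ
import Data.Nat.Coprimality as Coprime
open import Data.Fin as Fin using (Fin; zero; suc; punchIn; punchOut)
open import Data.Fin.Properties using (punchInᵢ≢i; punchIn-punchOut; punchOut-punchIn)
open import Data.Fin.Subset as Subset using (Subset; _∈_; _∉_; _⊆_; _⊂_; ⁅_⁆; _∪_; ∁; ∣_∣)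
open import Data.Fin.Subset.Properties
  using (_∈?_; ∉⊥; ⊥⊆; x∈⁅x⁆; x∈⁅y⁆⇒x≡y; x∈p∪q⁻; p⊆p∪q; q⊆p∪q; ∪-comm; ⊆-antisym; p⊂q⇒∣p∣<∣q∣;
         x∈∁p⇒x∉p; x∉p⇒x∈∁p)
open import Data.Vec using (Vec; lookup; map; zipWith; removeAt)
open import Data.Vec.Properties using (lookup-map; lookup-zipWith; lookup⇒[]=; []=⇒lookup; removeAt-punchOut)
open import Data.Vec.Functional using (insertAt; updateAt)
open import Data.Vec.Functional.Properties using (insertAt-lookup; insertAt-punchIn; updateAt-updates; updateAt-minimal)
open import Data.Bool using (not; if_then_else_)
open import Data.List using (List; []; _∷_; allFin)
open import Data.List.Relation.Unary.Any using (here; there)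
open import Data.List.Membership.Propositional using () renaming (_∈_ to _∈ˡ_)
open import Data.List.Membership.Propositional.Properties using (∈-allFin)
open import Data.Integer as ℤ using (-[1+_])
open import Data.Rational as ℚ using (ℚ; _≤_; _+_; _*_; -_; _-_; _⊓_; ½; 0ℚ; 1ℚ; mkℚ; ↧ₙ_)
import Data.Rational.Properties as ℚ
open import Data.Rational.Solver using (module +-*-Solver)
open import Data.Product as Product using (∃; ∃-syntax; ∃₂; _×_; _,_; proj₁; proj₂)
open import Data.Sum as Sum using (_⊎_; inj₁; inj₂)
open import Data.Empty using (⊥; ⊥-elim)
open import Function.Base using (_∘_; id)
open import Function.Bundles using (_⇔_; mk⇔; Equivalence)
open import Effect.Monad using (RawMonad)
open import Relation.Nullary using (¬_; Dec; yes; no; does)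
open import Relation.Nullary.Decidable using (decidable-stable; dec-true; dec-false; ¬¬-excluded-middle)
open import Relation.Nullary.Negation using (¬¬-map; ¬¬-Monad)
open import Relation.Binary.PropositionalEquality
  using (_≡_; _≢_; refl; sym; trans; cong; cong₂; cong-app; subst; subst₂; module ≡-Reasoning)
open import Algebra.Bundles using (CommutativeRing)
open import Algebra.Structures using (IsCommutativeRing)
open import Algebra.Properties.CommutativeMonoid.Sum ℚ.+-0-commutativeMonoid using (sum; sum-remove)
open import Algebra.Properties.Group ℚ.+-0-group using (⁻¹-involutive)
import Algebra.Properties.Group as GroupProperties
import Algebra.Properties.Ring as RingProperties
import Algebra.Solver.CommutativeMonoid as CommutativeMonoidSolver

open RawMonad (¬¬-Monad {0ℓ}) using (pure; _>>=_)

IsInteger : ℚ → Set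
IsInteger p = ∃[ k ] (p ≡ k ℚ./ 1)

↧ₙ-/1 : ∀ k → ↧ₙ (k ℚ./ 1) ≡ 1
↧ₙ-/1 (ℤ.+ n) = cong ↧ₙ_ (ℚ.normalize-coprime {n} {0} (Coprime.sym (Coprime.1-coprimeTo n)))
↧ₙ-/1 -[1+ n ] =
  cong (↧ₙ_ ∘ -_) (ℚ.normalize-coprime {suc n} {0} (Coprime.sym (Coprime.1-coprimeTo (suc n))))

isInteger? : (p : ℚ) → Dec (IsInteger p)
isInteger? p@(mkℚ k zero _) = yes (k , sym (ℚ.↥p/↧p≡p p))
isInteger? (mkℚ _ (suc _) _) =
  no λ (k , p≡k) → ℕ.1+n≢0 (ℕ.suc-injective (trans (cong ↧ₙ_ p≡k) (↧ₙ-/1 k)))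

nonneg-midpoint-zero : ∀ {p r} → 0ℚ ≤ p → 0ℚ ≤ r → 0ℚ ≡ ½ * (p + r) → p ≡ 0ℚ × r ≡ 0ℚ
nonneg-midpoint-zero {p} {r} 0≤p 0≤r 0≡mid =
  ℚ.≤-antisym (subst₂ _≤_ (ℚ.+-identityʳ p) p+r≡0 (ℚ.+-monoʳ-≤ p 0≤r)) 0≤p ,
  ℚ.≤-antisym (subst₂ _≤_ (ℚ.+-identityˡ r) p+r≡0 (ℚ.+-monoˡ-≤ r 0≤p)) 0≤r
  where
  open +-*-Solver
  double-half : ∀ x → x ≡ (ℤ.+ 2 ℚ./ 1) * (½ * x)
  double-half = solve 1 (λ x → x := con (ℤ.+ 2 ℚ./ 1) :* (con ½ :* x)) refl
  p+r≡0 : p + r ≡ 0ℚ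
  p+r≡0 = trans (double-half (p + r)) (cong ((ℤ.+ 2 ℚ./ 1) *_) (sym 0≡mid))

midpoint-± : ∀ x d → x ≡ ½ * ((x + d) + (x + - d))
midpoint-± = solve 2 (λ x d → x := con ½ :* ((x :+ d) :+ (x :+ :- d))) refl
  where open +-*-Solver

midpoint-cong : ∀ {x x′ y y′} → x ≡ x′ → y ≡ y′ → ½ * (x + y) ≡ ½ * (x′ + y′)
midpoint-cong = cong₂ (λ x y → ½ * (x + y))

±-equal⇒zero : ∀ x d → x + d ≡ x + - d → d ≡ 0ℚ
±-equal⇒zero x d x+d≡x-d = begin
  d                                ≡⟨ half-difference x d ⟩
  ½ * ((x + d) - (x + - d))        ≡⟨ cong (λ y → ½ * (y - (x + - d))) x+d≡x-d ⟩
  ½ * ((x + - d) - (x + - d))      ≡⟨ cong (½ *_) (ℚ.+-inverseʳ (x + - d)) ⟩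
  0ℚ                               ∎
  where
  open ≡-Reasoning
  open +-*-Solver
  half-difference : ∀ x d → d ≡ ½ * ((x + d) - (x + - d))
  half-difference = solve 2 (λ x d → d := con ½ :* ((x :+ d) :- (x :+ :- d))) refl

p≤q⇒0≤q-p : ∀ {p q} → p ≤ q → 0ℚ ≤ q - p
p≤q⇒0≤q-p {p} {q} p≤q = subst (_≤ q - p) (ℚ.+-inverseʳ p) (ℚ.+-monoˡ-≤ (- p) p≤q)

-- The covering polyhedron of mult(S)

module Polyhedron {q : ℕ} (F : FiniteField q) where

  multIdeal-stable : ∀ {n} {S : Vector F n → Set} → ¬ ¬ MultIdeal F S → MultIdeal F S
  multIdeal-stable ¬¬ideal w extreme k a =
    decidable-stable (isInteger? (w k a)) (¬¬-map (λ ideal → ideal w extreme k a) ¬¬ideal)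

  sumFin≡sum : ∀ {n} (f : Fin n → ℚ) → sumFin F f ≡ sum f
  sumFin≡sum {zero} f = refl
  sumFin≡sum {suc n} f = cong (f zero +_) (sumFin≡sum (f ∘ suc))

  sumFin-cong : ∀ {n} {f g : Fin n → ℚ} → (∀ k → f k ≡ g k) → sumFin F f ≡ sumFin F g
  sumFin-cong {zero} f≗g = refl
  sumFin-cong {suc n} f≗g = cong₂ _+_ (f≗g zero) (sumFin-cong (f≗g ∘ suc))

  sumFin-remove : ∀ {n} (f : Fin (suc n) → ℚ) j → sumFin F f ≡ f j + sumFin F (f ∘ punchIn j)
  sumFin-remove f j = begin
    sumFin F f                       ≡⟨ sumFin≡sum f ⟩
    sum f                            ≡⟨ sum-remove {i = j} f ⟩
    f j + sum (f ∘ punchIn j)        ≡⟨ cong (f j +_) (sym (sumFin≡sum (f ∘ punchIn j))) ⟩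
    f j + sumFin F (f ∘ punchIn j)   ∎
    where open ≡-Reasoning

  sumFin-bump : ∀ {n} (f g : Fin n → ℚ) i t →
    (∀ k → k ≢ i → f k ≡ g k) → f i ≡ g i + t → sumFin F f ≡ sumFin F g + t
  sumFin-bump {suc n} f g i t f≗g fi≡gi+t = begin
    sumFin F f                                 ≡⟨ sumFin-remove f i ⟩
    f i + sumFin F (f ∘ punchIn i)             ≡⟨ cong₂ _+_ fi≡gi+t (sumFin-cong (λ k → f≗g _ (punchInᵢ≢i i k))) ⟩
    (g i + t) + sumFin F (g ∘ punchIn i)       ≡⟨ swap (g i) t _ ⟩
    (g i + sumFin F (g ∘ punchIn i)) + t       ≡⟨ cong (_+ t) (sym (sumFin-remove g i)) ⟩
    sumFin F g + t                             ∎
    where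
    open ≡-Reasoning
    swap : ∀ a t r → (a + t) + r ≡ (a + r) + t
    swap = +-*-Solver.solve 3 (λ a t r → (a :+ t) :+ r := (a :+ r) :+ t) refl
      where open +-*-Solver

  cost : ∀ {n} → Weight F n → Vector F n → ℚ
  cost w x = sumFin F (λ k → w k (lookup x k))

  NonNegative : ∀ {n} → Weight F n → Set
  NonNegative w = ∀ k a → 0ℚ ≤ w k a

  infix 4 _≗ʷ_
  _≗ʷ_ : ∀ {n} → Weight F n → Weight F n → Set
  u ≗ʷ v = ∀ k a → u k a ≡ v k a

  IsMidpoint : ∀ {n} → Weight F n → Weight F n → Weight F n → Set
  IsMidpoint w u v = ∀ k a → w k a ≡ ½ * (u k a + v k a)

  inPolyhedron-cong : ∀ {n} {T : Vector F n → Set} {u v : Weight F n} →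
    u ≗ʷ v → InPolyhedron F T u → InPolyhedron F T v
  inPolyhedron-cong u≗v (u≥0 , u-covers) =
    (λ k a → subst (0ℚ ≤_) (u≗v k a) (u≥0 k a)) ,
    (λ x x∈T → subst (1ℚ ≤_) (sumFin-cong (λ k → u≗v k (lookup x k))) (u-covers x x∈T))

  extreme-rigid : ∀ {n} {T : Vector F n → Set} {w : Weight F n} → IsExtreme F T w →
    (d : Weight F n) → InPolyhedron F T (λ k a → w k a + d k a) →
    InPolyhedron F T (λ k a → w k a + - d k a) → ∀ k a → d k a ≡ 0ℚ
  extreme-rigid {w = w} (_ , extreme) d w+d∈P w-d∈P k a =
    ±-equal⇒zero (w k a) (d k a) (extreme _ _ w+d∈P w-d∈P (λ k a → midpoint-± (w k a) (d k a)) k a)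

-- Merging coordinate j into coordinate i

lookup-removeAt : ∀ {A : Set} {n} (x : Vec A (suc n)) j k →
  lookup (removeAt x j) k ≡ lookup x (punchIn j k)
lookup-removeAt x j k =
  trans (cong (lookup (removeAt x j)) (sym (punchOut-punchIn j))) (removeAt-punchOut x (punchInᵢ≢i j k ∘ sym))

module Merge {q : ℕ} (F : FiniteField q) {m : ℕ} (S : Vector F (suc m) → Set)
  (j : Fin (suc m)) (i′ : Fin m)
  (φ ψ : FiniteField.Carrier F → FiniteField.Carrier F)
  (ψ∘φ : ∀ a → ψ (φ a) ≡ a) (φ∘ψ : ∀ b → φ (ψ b) ≡ b)
  (determined : ∀ x → S x → lookup x j ≡ φ (lookup x (punchIn j i′)))
  where

  open FiniteField F using (Carrier; _≟_)
  open Polyhedron F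

  i : Fin (suc m)
  i = punchIn j i′

  S′ : Vector F m → Set
  S′ = dropCoord F j S

  data Coordinate : Fin (suc m) → Set where
    at-j : Coordinate j
    at-i : Coordinate i
    elsewhere : ∀ k → k ≢ i′ → Coordinate (punchIn j k)

  coordinate : ∀ k → Coordinate k
  coordinate k with j Fin.≟ k
  ... | yes refl = at-j
  ... | no j≢k with punchOut j≢k Fin.≟ i′
  ...   | yes k′≡i′ = subst Coordinate (trans (cong (punchIn j) (sym k′≡i′)) (punchIn-punchOut j≢k)) at-i
  ...   | no k′≢i′ = subst Coordinate (punchIn-punchOut j≢k) (elsewhere (punchOut j≢k) k′≢i′)

  assemble : (Carrier → ℚ) → (Carrier → ℚ) → Weight F m → Weight F (suc m)
  assemble at-j-values at-i-values rest = insertAt (updateAt rest i′ (λ _ → at-i-values)) j at-j-values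

  assemble-at-j : ∀ g h r b → assemble g h r j b ≡ g b
  assemble-at-j g h r = cong-app (insertAt-lookup (updateAt r i′ (λ _ → h)) j g)

  assemble-at-i : ∀ g h r a → assemble g h r i a ≡ h a
  assemble-at-i g h r a = trans (cong-app (insertAt-punchIn (updateAt r i′ (λ _ → h)) j g i′) a)
                                (cong-app (updateAt-updates i′ r) a)

  assemble-elsewhere : ∀ g h r {k} → k ≢ i′ → ∀ a → assemble g h r (punchIn j k) a ≡ r k a
  assemble-elsewhere g h r {k} k≢i′ a =
    trans (cong-app (insertAt-punchIn (updateAt r i′ (λ _ → h)) j g k) a) (cong-app (updateAt-minimal k i′ r k≢i′) a)

  collapse : Weight F (suc m) → Weight F m
  collapse u = updateAt (λ k → u (punchIn j k)) i′ (λ f a → f a + u j (φ a))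

  collapse-at-i′ : ∀ u a → collapse u i′ a ≡ u i a + u j (φ a)
  collapse-at-i′ u = cong-app (updateAt-updates i′ (λ k → u (punchIn j k)))

  collapse-elsewhere : ∀ u {k} → k ≢ i′ → ∀ a → collapse u k a ≡ u (punchIn j k) a
  collapse-elsewhere u {k} k≢i′ = cong-app (updateAt-minimal k i′ (λ k → u (punchIn j k)) k≢i′)

  collapse-cong : ∀ {u v} → u ≗ʷ v → collapse u ≗ʷ collapse v
  collapse-cong {u} {v} u≗v k a with k Fin.≟ i′
  ... | yes refl = begin
    collapse u i′ a          ≡⟨ collapse-at-i′ u a ⟩
    u i a + u j (φ a)        ≡⟨ cong₂ _+_ (u≗v i a) (u≗v j (φ a)) ⟩
    v i a + v j (φ a)        ≡⟨ collapse-at-i′ v a ⟨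
    collapse v i′ a          ∎
    where open ≡-Reasoning
  ... | no k≢i′ = trans (collapse-elsewhere u k≢i′ a) (trans (u≗v _ a) (sym (collapse-elsewhere v k≢i′ a)))

  collapse-vanishing : ∀ u → (∀ b → u j b ≡ 0ℚ) → ∀ k a → collapse u k a ≡ u (punchIn j k) a
  collapse-vanishing u uj≡0 k a with k Fin.≟ i′
  ... | yes refl = trans (collapse-at-i′ u a) (trans (cong (u i a +_) (uj≡0 (φ a))) (ℚ.+-identityʳ (u i a)))
  ... | no k≢i′ = collapse-elsewhere u k≢i′ a

  collapse-nonneg : ∀ {u} → NonNegative u → NonNegative (collapse u)
  collapse-nonneg {u} u≥0 k a with k Fin.≟ i′
  ... | yes refl = subst (0ℚ ≤_) (sym (collapse-at-i′ u a)) (ℚ.+-mono-≤ (u≥0 i a) (u≥0 j (φ a)))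
  ... | no k≢i′ = subst (0ℚ ≤_) (sym (collapse-elsewhere u k≢i′ a)) (u≥0 (punchIn j k) a)

  cost-collapse : ∀ u x → S x → cost (collapse u) (removeAt x j) ≡ cost u x
  cost-collapse u x x∈S = begin
    cost (collapse u) (removeAt x j)   ≡⟨ sumFin-bump _ g i′ (u j (lookup x j)) agree-elsewhere agree-at-i′ ⟩
    sumFin F g + u j (lookup x j)      ≡⟨ ℚ.+-comm (sumFin F g) _ ⟩
    u j (lookup x j) + sumFin F g      ≡⟨ sumFin-remove (λ k → u k (lookup x k)) j ⟨
    cost u x                           ∎
    where
    open ≡-Reasoning
    g : Fin m → ℚ
    g k = u (punchIn j k) (lookup x (punchIn j k))
    agree-elsewhere : ∀ k → k ≢ i′ → collapse u k (lookup (removeAt x j) k) ≡ g k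
    agree-elsewhere k k≢i′ =
      trans (collapse-elsewhere u k≢i′ _) (cong (u (punchIn j k)) (lookup-removeAt x j k))
    agree-at-i′ : collapse u i′ (lookup (removeAt x j) i′) ≡ g i′ + u j (lookup x j)
    agree-at-i′ rewrite lookup-removeAt x j i′ | determined x x∈S = collapse-at-i′ u (lookup x i)

  collapse-inPolyhedron : ∀ {u} → InPolyhedron F S u → InPolyhedron F S′ (collapse u)
  collapse-inPolyhedron {u} (u≥0 , u-covers) = collapse-nonneg u≥0 , λ where
    _ (x , x∈S , refl) → subst (1ℚ ≤_) (sym (cost-collapse u x x∈S)) (u-covers x x∈S)

  inPolyhedron-uncollapse : ∀ {u} → NonNegative u → InPolyhedron F S′ (collapse u) → InPolyhedron F S u
  inPolyhedron-uncollapse {u} u≥0 (_ , collapse-covers) = u≥0 , λ x x∈S →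
    subst (1ℚ ≤_) (cost-collapse u x x∈S) (collapse-covers (removeAt x j) (x , x∈S , refl))

  lift : Weight F m → Weight F (suc m)
  lift w′ = insertAt w′ j (λ _ → 0ℚ)

  lift-at-j : ∀ w′ b → lift w′ j b ≡ 0ℚ
  lift-at-j w′ = cong-app (insertAt-lookup w′ j _)

  lift-at-punchIn : ∀ w′ k a → lift w′ (punchIn j k) a ≡ w′ k a
  lift-at-punchIn w′ k = cong-app (insertAt-punchIn w′ j _ k)

  lift-nonneg : ∀ {w′} → NonNegative w′ → NonNegative (lift w′)
  lift-nonneg {w′} w′≥0 k a with coordinate k
  ... | at-j = subst (0ℚ ≤_) (sym (lift-at-j w′ a)) ℚ.≤-refl
  ... | at-i = subst (0ℚ ≤_) (sym (lift-at-punchIn w′ i′ a)) (w′≥0 i′ a)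
  ... | elsewhere k _ = subst (0ℚ ≤_) (sym (lift-at-punchIn w′ k a)) (w′≥0 k a)

  collapse-lift : ∀ w′ → collapse (lift w′) ≗ʷ w′
  collapse-lift w′ k a = trans (collapse-vanishing (lift w′) (lift-at-j w′) k a) (lift-at-punchIn w′ k a)

  lift-inPolyhedron : ∀ {w′} → InPolyhedron F S′ w′ → InPolyhedron F S (lift w′)
  lift-inPolyhedron {w′} w′∈P = inPolyhedron-uncollapse (lift-nonneg (proj₁ w′∈P))
    (inPolyhedron-cong (λ k a → sym (collapse-lift w′ k a)) w′∈P)

  lift-rigid : ∀ {w′} → IsExtreme F S′ w′ → ∀ u v → InPolyhedron F S u → InPolyhedron F S v →
    IsMidpoint (lift w′) u v → u ≗ʷ v
  lift-rigid {w′} (_ , w′-extreme) u v u∈P v∈P mid = agree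
    where
    vanish-at-j : ∀ b → u j b ≡ 0ℚ × v j b ≡ 0ℚ
    vanish-at-j b =
      nonneg-midpoint-zero (proj₁ u∈P j b) (proj₁ v∈P j b) (trans (sym (lift-at-j w′ b)) (mid j b))
    collapse-u : ∀ k a → collapse u k a ≡ u (punchIn j k) a
    collapse-u = collapse-vanishing u (proj₁ ∘ vanish-at-j)
    collapse-v : ∀ k a → collapse v k a ≡ v (punchIn j k) a
    collapse-v = collapse-vanishing v (proj₂ ∘ vanish-at-j)
    collapse-mid : IsMidpoint w′ (collapse u) (collapse v)
    collapse-mid k a = begin
      w′ k a                                        ≡⟨ lift-at-punchIn w′ k a ⟨
      lift w′ (punchIn j k) a                       ≡⟨ mid (punchIn j k) a ⟩
      ½ * (u (punchIn j k) a + v (punchIn j k) a)   ≡⟨ midpoint-cong (collapse-u k a) (collapse-v k a) ⟨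
      ½ * (collapse u k a + collapse v k a)         ∎
      where open ≡-Reasoning
    collapse-u∈P : InPolyhedron F S′ (collapse u)
    collapse-u∈P = collapse-inPolyhedron u∈P
    collapse-v∈P : InPolyhedron F S′ (collapse v)
    collapse-v∈P = collapse-inPolyhedron v∈P
    agree-off-j : ∀ k a → u (punchIn j k) a ≡ v (punchIn j k) a
    agree-off-j k a = begin
      u (punchIn j k) a   ≡⟨ collapse-u k a ⟨
      collapse u k a      ≡⟨ w′-extreme _ _ collapse-u∈P collapse-v∈P collapse-mid k a ⟩
      collapse v k a      ≡⟨ collapse-v k a ⟩
      v (punchIn j k) a   ∎
      where open ≡-Reasoning
    agree : u ≗ʷ v
    agree k a with coordinate k
    ... | at-j = trans (proj₁ (vanish-at-j a)) (sym (proj₂ (vanish-at-j a)))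
    ... | at-i = agree-off-j i′ a
    ... | elsewhere k _ = agree-off-j k a

  lift-extreme : ∀ {w′} → IsExtreme F S′ w′ → IsExtreme F S (lift w′)
  lift-extreme w′-extreme = lift-inPolyhedron (proj₁ w′-extreme) , lift-rigid w′-extreme

  drop-ideal : MultIdeal F S → MultIdeal F S′
  drop-ideal ideal w′ w′-extreme k a with ideal (lift w′) (lift-extreme w′-extreme) (punchIn j k) a
  ... | z , lift≡z = z , trans (sym (lift-at-punchIn w′ k a)) lift≡z

  φ-injective : ∀ {a b} → φ a ≡ φ b → a ≡ b
  φ-injective {a} {b} φa≡φb = trans (sym (ψ∘φ a)) (trans (cong ψ φa≡φb) (ψ∘φ b))

  spike : Carrier → ℚ → Carrier → ℚ
  spike a t b = if does (b ≟ a) then t else 0ℚ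

  spike-at : ∀ a t → spike a t a ≡ t
  spike-at a t = cong (if_then t else 0ℚ) (dec-true (a ≟ a) refl)

  spike-off : ∀ {a b} t → b ≢ a → spike a t b ≡ 0ℚ
  spike-off {a} {b} t b≢a = cong (if_then t else 0ℚ) (dec-false (b ≟ a) b≢a)

  spike-neg : ∀ a t b → spike a (- t) b ≡ - spike a t b
  spike-neg a t b with b ≟ a
  ... | yes _ = refl
  ... | no _ = refl

  spikes-cancel : ∀ a t b → spike a t b + spike (φ a) (- t) (φ b) ≡ 0ℚ
  spikes-cancel a t b with b ≟ a
  ... | yes refl = trans (cong (t +_) (spike-at (φ a) (- t))) (ℚ.+-inverseʳ t)
  ... | no b≢a = cong (0ℚ +_) (spike-off (- t) (b≢a ∘ φ-injective))

  spike-nonneg : ∀ {f : Carrier → ℚ} a t → (∀ b → 0ℚ ≤ f b) → 0ℚ ≤ f a + t → ∀ b → 0ℚ ≤ f b + spike a t b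
  spike-nonneg {f} a t f≥0 0≤fa+t b with b ≟ a
  ... | yes refl = 0≤fa+t
  ... | no _ = subst (0ℚ ≤_) (sym (ℚ.+-identityʳ (f b))) (f≥0 b)

  -- A member of mult(S) contains both (i, a) and (j, φ a) or neither, so moving weight
  -- between these two vertices changes no covering constraint.
  transfer : Carrier → ℚ → Weight F (suc m)
  transfer a t = assemble (spike (φ a) (- t)) (spike a t) (λ _ _ → 0ℚ)

  transfer-elsewhere : ∀ a t {k} → k ≢ i′ → ∀ b → transfer a t (punchIn j k) b ≡ 0ℚ
  transfer-elsewhere a t = assemble-elsewhere (spike (φ a) (- t)) (spike a t) (λ _ _ → 0ℚ)

  transfer-neg : ∀ a t k b → transfer a (- t) k b ≡ - transfer a t k b
  transfer-neg a t k b with coordinate k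
  ... | at-j = trans (assemble-at-j _ _ _ b)
                 (trans (spike-neg (φ a) (- t) b) (cong -_ (sym (assemble-at-j _ _ _ b))))
  ... | at-i = trans (assemble-at-i _ _ _ b)
                 (trans (spike-neg a t b) (cong -_ (sym (assemble-at-i _ _ _ b))))
  ... | elsewhere k k≢i′ = trans (transfer-elsewhere a (- t) k≢i′ b) (cong -_ (sym (transfer-elsewhere a t k≢i′ b)))

  module _ (w : Weight F (suc m)) (a : Carrier) where

    shift : ℚ → Weight F (suc m)
    shift t k b = w k b + transfer a t k b

    shift-nonneg : ∀ t → NonNegative w → 0ℚ ≤ w i a + t → 0ℚ ≤ w j (φ a) + - t → NonNegative (shift t)
    shift-nonneg t w≥0 0≤wi+t 0≤wj-t k b with coordinate k
    ... | at-j = subst (0ℚ ≤_) (cong (w j b +_) (sym (assemble-at-j _ _ _ b)))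
                   (spike-nonneg (φ a) (- t) (w≥0 j) 0≤wj-t b)
    ... | at-i = subst (0ℚ ≤_) (cong (w i b +_) (sym (assemble-at-i _ _ _ b)))
                   (spike-nonneg a t (w≥0 i) 0≤wi+t b)
    ... | elsewhere k k≢i′ =
      subst (0ℚ ≤_) (trans (sym (ℚ.+-identityʳ _)) (cong (w _ b +_) (sym (transfer-elsewhere a t k≢i′ b)))) (w≥0 _ b)

    collapse-shift : ∀ t → collapse (shift t) ≗ʷ collapse w
    collapse-shift t k b with k Fin.≟ i′
    ... | yes refl = begin
      collapse (shift t) i′ b
        ≡⟨ collapse-at-i′ (shift t) b ⟩
      (w i b + transfer a t i b) + (w j (φ b) + transfer a t j (φ b))
        ≡⟨ cong₂ (λ x y → (w i b + x) + (w j (φ b) + y)) (assemble-at-i _ _ _ b) (assemble-at-j _ _ _ (φ b)) ⟩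
      (w i b + spike a t b) + (w j (φ b) + spike (φ a) (- t) (φ b))
        ≡⟨ interchange (w i b) _ (w j (φ b)) _ ⟩
      (w i b + w j (φ b)) + (spike a t b + spike (φ a) (- t) (φ b))
        ≡⟨ cong ((w i b + w j (φ b)) +_) (spikes-cancel a t b) ⟩
      (w i b + w j (φ b)) + 0ℚ
        ≡⟨ ℚ.+-identityʳ _ ⟩
      w i b + w j (φ b)
        ≡⟨ collapse-at-i′ w b ⟨
      collapse w i′ b
        ∎
      where
      open ≡-Reasoning
      interchange : ∀ x p y r → (x + p) + (y + r) ≡ (x + y) + (p + r)
      interchange = +-*-Solver.solve 4 (λ x p y r → (x :+ p) :+ (y :+ r) := (x :+ y) :+ (p :+ r)) refl
        where open +-*-Solver
    ... | no k≢i′ = begin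
      collapse (shift t) k b                            ≡⟨ collapse-elsewhere (shift t) k≢i′ b ⟩
      w (punchIn j k) b + transfer a t (punchIn j k) b  ≡⟨ cong (w (punchIn j k) b +_) (transfer-elsewhere a t k≢i′ b) ⟩
      w (punchIn j k) b + 0ℚ                            ≡⟨ ℚ.+-identityʳ _ ⟩
      w (punchIn j k) b                                 ≡⟨ collapse-elsewhere w k≢i′ b ⟨
      collapse w k b                                    ∎
      where open ≡-Reasoning

    shift-inPolyhedron : InPolyhedron F S w → ∀ t → 0ℚ ≤ w i a + t → 0ℚ ≤ w j (φ a) + - t →
      InPolyhedron F S (shift t)
    shift-inPolyhedron w∈P@(w≥0 , _) t 0≤wi+t 0≤wj-t = inPolyhedron-uncollapse (shift-nonneg t w≥0 0≤wi+t 0≤wj-t)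
      (inPolyhedron-cong (λ k b → sym (collapse-shift t k b)) (collapse-inPolyhedron w∈P))

  complementary : ∀ {w} → IsExtreme F S w → ∀ a → w i a ≡ 0ℚ ⊎ w j (φ a) ≡ 0ℚ
  complementary {w} w-extreme@(w∈P@(w≥0 , _) , _) a =
    Sum.map (λ s≡wi → trans (sym s≡wi) s≡0) (λ s≡wj → trans (sym s≡wj) s≡0) (ℚ.⊓-sel (w i a) (w j (φ a)))
    where
    s : ℚ
    s = w i a ⊓ w j (φ a)
    0≤s : 0ℚ ≤ s
    0≤s = ℚ.⊓-glb (w≥0 i a) (w≥0 j (φ a))
    shift∈P : ∀ t → 0ℚ ≤ w i a + t → 0ℚ ≤ w j (φ a) + - t → InPolyhedron F S (shift w a t)
    shift∈P = shift-inPolyhedron w a w∈P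
    w+d∈P : InPolyhedron F S (shift w a s)
    w+d∈P = shift∈P s (ℚ.+-mono-≤ (w≥0 i a) 0≤s) (p≤q⇒0≤q-p {s} {w j (φ a)} (ℚ.p⊓q≤q (w i a) _))
    w-d∈P : InPolyhedron F S (λ k b → w k b + - transfer a s k b)
    w-d∈P = inPolyhedron-cong (λ k b → cong (w k b +_) (transfer-neg a s k b))
      (shift∈P (- s) (p≤q⇒0≤q-p {s} {w i a} (ℚ.p⊓q≤p _ (w j (φ a))))
        (subst (λ x → 0ℚ ≤ w j (φ a) + x) (sym (⁻¹-involutive s)) (ℚ.+-mono-≤ (w≥0 j (φ a)) 0≤s)))
    s≡0 : s ≡ 0ℚ
    s≡0 = begin
      s                    ≡⟨ spike-at a s ⟨
      spike a s a          ≡⟨ assemble-at-i _ _ _ a ⟨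
      transfer a s i a     ≡⟨ extreme-rigid w-extreme (transfer a s) w+d∈P w-d∈P i a ⟩
      0ℚ                   ∎
      where open ≡-Reasoning

  module Split {w : Weight F (suc m)} (w-extreme : IsExtreme F S w) where

    vanishes-at-j? : ∀ a → Dec (w j (φ a) ≡ 0ℚ)
    vanishes-at-j? a = w j (φ a) ℚ.≟ 0ℚ

    wi≡collapse : ∀ {a} → w j (φ a) ≡ 0ℚ → w i a ≡ collapse w i′ a
    wi≡collapse {a} wj≡0 = begin
      w i a                ≡⟨ ℚ.+-identityʳ (w i a) ⟨
      w i a + 0ℚ           ≡⟨ cong (w i a +_) wj≡0 ⟨
      w i a + w j (φ a)    ≡⟨ collapse-at-i′ w a ⟨
      collapse w i′ a      ∎
      where open ≡-Reasoning

    wj≡collapse : ∀ {a} → w i a ≡ 0ℚ → w j (φ a) ≡ collapse w i′ a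
    wj≡collapse {a} wi≡0 = begin
      w j (φ a)            ≡⟨ ℚ.+-identityˡ (w j (φ a)) ⟨
      0ℚ + w j (φ a)       ≡⟨ cong (_+ w j (φ a)) wi≡0 ⟨
      w i a + w j (φ a)    ≡⟨ collapse-at-i′ w a ⟨
      collapse w i′ a      ∎
      where open ≡-Reasoning

    keep-at-i keep-at-j : Weight F m → Carrier → ℚ
    keep-at-i u′ a = if does (vanishes-at-j? a) then u′ i′ a else 0ℚ
    keep-at-j u′ a = if does (vanishes-at-j? a) then 0ℚ else u′ i′ a

    -- Undoes collapse below w: the weight of (i′, a) goes to whichever of (i, a), (j, φ a)
    -- may be nonzero in w.
    split : Weight F m → Weight F (suc m)
    split u′ = assemble (keep-at-j u′ ∘ ψ) (keep-at-i u′) u′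

    keep-at-i-yes : ∀ u′ {a} → w j (φ a) ≡ 0ℚ → keep-at-i u′ a ≡ u′ i′ a
    keep-at-i-yes u′ {a} wj≡0 = cong (if_then u′ i′ a else 0ℚ) (dec-true (vanishes-at-j? a) wj≡0)

    keep-at-i-no : ∀ u′ {a} → w j (φ a) ≢ 0ℚ → keep-at-i u′ a ≡ 0ℚ
    keep-at-i-no u′ {a} wj≢0 = cong (if_then u′ i′ a else 0ℚ) (dec-false (vanishes-at-j? a) wj≢0)

    keep-at-j-yes : ∀ u′ {a} → w j (φ a) ≡ 0ℚ → keep-at-j u′ a ≡ 0ℚ
    keep-at-j-yes u′ {a} wj≡0 = cong (if_then 0ℚ else u′ i′ a) (dec-true (vanishes-at-j? a) wj≡0)

    keep-at-j-no : ∀ u′ {a} → w j (φ a) ≢ 0ℚ → keep-at-j u′ a ≡ u′ i′ a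
    keep-at-j-no u′ {a} wj≢0 = cong (if_then 0ℚ else u′ i′ a) (dec-false (vanishes-at-j? a) wj≢0)

    wi-vanishes : ∀ {a} → w j (φ a) ≢ 0ℚ → w i a ≡ 0ℚ
    wi-vanishes {a} wj≢0 = Sum.[ id , (λ wj≡0 → ⊥-elim (wj≢0 wj≡0)) ]′ (complementary w-extreme a)

    keep-sum : ∀ u′ a → keep-at-i u′ a + keep-at-j u′ a ≡ u′ i′ a
    keep-sum u′ a with vanishes-at-j? a
    ... | yes _ = ℚ.+-identityʳ (u′ i′ a)
    ... | no _ = ℚ.+-identityˡ (u′ i′ a)

    collapse-split : ∀ u′ → collapse (split u′) ≗ʷ u′
    collapse-split u′ k a with k Fin.≟ i′
    ... | yes refl = begin
      collapse (split u′) i′ a                       ≡⟨ collapse-at-i′ (split u′) a ⟩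
      split u′ i a + split u′ j (φ a)                ≡⟨ cong₂ _+_ (assemble-at-i _ _ _ a) (assemble-at-j _ _ _ (φ a)) ⟩
      keep-at-i u′ a + keep-at-j u′ (ψ (φ a))        ≡⟨ cong (λ c → keep-at-i u′ a + keep-at-j u′ c) (ψ∘φ a) ⟩
      keep-at-i u′ a + keep-at-j u′ a                ≡⟨ keep-sum u′ a ⟩
      u′ i′ a                                        ∎
      where open ≡-Reasoning
    ... | no k≢i′ = trans (collapse-elsewhere (split u′) k≢i′ a) (assemble-elsewhere _ _ _ k≢i′ a)

    split-nonneg : ∀ {u′} → NonNegative u′ → NonNegative (split u′)
    split-nonneg {u′} u′≥0 k b with coordinate k
    ... | at-j = subst (0ℚ ≤_) (sym (assemble-at-j _ _ _ b)) (keep-at-j≥0 (ψ b))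
      where
      keep-at-j≥0 : ∀ a → 0ℚ ≤ keep-at-j u′ a
      keep-at-j≥0 a with vanishes-at-j? a
      ... | yes _ = ℚ.≤-refl
      ... | no _ = u′≥0 i′ a
    ... | at-i = subst (0ℚ ≤_) (sym (assemble-at-i _ _ _ b)) keep-at-i≥0
      where
      keep-at-i≥0 : 0ℚ ≤ keep-at-i u′ b
      keep-at-i≥0 with vanishes-at-j? b
      ... | yes _ = u′≥0 i′ b
      ... | no _ = ℚ.≤-refl
    ... | elsewhere k k≢i′ = subst (0ℚ ≤_) (sym (assemble-elsewhere _ _ _ k≢i′ b)) (u′≥0 k b)

    module _ {u′ v′ : Weight F m} (mid : IsMidpoint (collapse w) u′ v′) where

      midpoint-at-i : ∀ a → Dec (w j (φ a) ≡ 0ℚ) → w i a ≡ ½ * (keep-at-i u′ a + keep-at-i v′ a)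
      midpoint-at-i a (yes wj≡0) = begin
        w i a                                   ≡⟨ wi≡collapse wj≡0 ⟩
        collapse w i′ a                         ≡⟨ mid i′ a ⟩
        ½ * (u′ i′ a + v′ i′ a)                 ≡⟨ midpoint-cong (keep-at-i-yes u′ wj≡0) (keep-at-i-yes v′ wj≡0) ⟨
        ½ * (keep-at-i u′ a + keep-at-i v′ a)   ∎
        where open ≡-Reasoning
      midpoint-at-i a (no wj≢0) =
        trans (wi-vanishes wj≢0) (sym (midpoint-cong (keep-at-i-no u′ wj≢0) (keep-at-i-no v′ wj≢0)))

      midpoint-at-j : ∀ a → Dec (w j (φ a) ≡ 0ℚ) → w j (φ a) ≡ ½ * (keep-at-j u′ a + keep-at-j v′ a)
      midpoint-at-j a (yes wj≡0) = trans wj≡0 (sym (midpoint-cong (keep-at-j-yes u′ wj≡0) (keep-at-j-yes v′ wj≡0)))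
      midpoint-at-j a (no wj≢0) = begin
        w j (φ a)                               ≡⟨ wj≡collapse (wi-vanishes wj≢0) ⟩
        collapse w i′ a                         ≡⟨ mid i′ a ⟩
        ½ * (u′ i′ a + v′ i′ a)                 ≡⟨ midpoint-cong (keep-at-j-no u′ wj≢0) (keep-at-j-no v′ wj≢0) ⟨
        ½ * (keep-at-j u′ a + keep-at-j v′ a)   ∎
        where open ≡-Reasoning

      split-midpoint : IsMidpoint w (split u′) (split v′)
      split-midpoint k b with coordinate k
      ... | at-j = trans (cong (w j) (sym (φ∘ψ b)))
                     (trans (midpoint-at-j (ψ b) (vanishes-at-j? (ψ b)))
                            (sym (midpoint-cong (assemble-at-j _ _ _ b) (assemble-at-j _ _ _ b))))
      ... | at-i = trans (midpoint-at-i b (vanishes-at-j? b))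
                     (sym (midpoint-cong (assemble-at-i _ _ _ b) (assemble-at-i _ _ _ b)))
      ... | elsewhere k k≢i′ = trans (sym (collapse-elsewhere w k≢i′ b))
                                 (trans (mid k b)
                                        (sym (midpoint-cong (assemble-elsewhere _ _ _ k≢i′ b)
                                                            (assemble-elsewhere _ _ _ k≢i′ b))))

    collapse-extreme : IsExtreme F S′ (collapse w)
    collapse-extreme = collapse-inPolyhedron (proj₁ w-extreme) , collapse-rigid
      where
      split∈P : ∀ {u′} → InPolyhedron F S′ u′ → InPolyhedron F S (split u′)
      split∈P {u′} u′∈P = inPolyhedron-uncollapse (split-nonneg (proj₁ u′∈P))
        (inPolyhedron-cong (λ k a → sym (collapse-split u′ k a)) u′∈P)
      collapse-rigid : ∀ u′ v′ → InPolyhedron F S′ u′ → InPolyhedron F S′ v′ →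
                       IsMidpoint (collapse w) u′ v′ → u′ ≗ʷ v′
      collapse-rigid u′ v′ u′∈P v′∈P mid k a = begin
        u′ k a                   ≡⟨ collapse-split u′ k a ⟨
        collapse (split u′) k a  ≡⟨ collapse-cong split-agree k a ⟩
        collapse (split v′) k a  ≡⟨ collapse-split v′ k a ⟩
        v′ k a                   ∎
        where
        open ≡-Reasoning
        split-agree : split u′ ≗ʷ split v′
        split-agree = proj₂ w-extreme _ _ (split∈P u′∈P) (split∈P v′∈P) (split-midpoint mid)

    zero-or-collapsed : ∀ k b → w k b ≡ 0ℚ ⊎ ∃₂ λ k′ b′ → w k b ≡ collapse w k′ b′
    zero-or-collapsed k b with coordinate k
    ... | at-j = Sum.[ (λ wi≡0 → inj₂ (i′ , ψ b , trans wj≡wjφψ (wj≡collapse wi≡0))) ,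
                       (λ wj≡0 → inj₁ (trans wj≡wjφψ wj≡0)) ]′
                   (complementary w-extreme (ψ b))
      where
      wj≡wjφψ : w j b ≡ w j (φ (ψ b))
      wj≡wjφψ = cong (w j) (sym (φ∘ψ b))
    ... | at-i = Sum.map₂ (λ wj≡0 → i′ , b , wi≡collapse wj≡0) (complementary w-extreme b)
    ... | elsewhere k k≢i′ = inj₂ (k , b , sym (collapse-elsewhere w k≢i′ b))

  undrop-ideal : MultIdeal F S′ → MultIdeal F S
  undrop-ideal ideal′ w w-extreme k b with Split.zero-or-collapsed w-extreme k b
  ... | inj₁ w≡0 = ℤ.+ 0 , w≡0
  ... | inj₂ (k′ , b′ , w≡collapse) =
    Product.map₂ (trans w≡collapse) (ideal′ (collapse w) (Split.collapse-extreme w-extreme) k′ b′)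

  ideal⇔ : MultIdeal F S ⇔ MultIdeal F S′
  ideal⇔ = mk⇔ drop-ideal undrop-ideal

-- Linear algebra over GF(q) and the matroid of S

module FieldFacts {q : ℕ} (F : FiniteField q) where
  open FiniteField F
  open IsCommutativeRing isCommutativeRing
    using (*-comm; *-assoc; *-identityˡ; zeroʳ; +-identityʳ; -‿inverseʳ)

  ring : CommutativeRing 0ℓ 0ℓ
  ring = record { isCommutativeRing = isCommutativeRing }

  open GroupProperties (CommutativeRing.+-group ring) using (x∙y⁻¹≈ε⇒x≈y)
  open RingProperties (CommutativeRing.ring ring) using (-‿distribˡ-*)
  open CommutativeMonoidSolver (CommutativeRing.*-commutativeMonoid ring)
    using (solve; _⊜_) renaming (_⊕_ to _⊗_)

  neg-·ˡ : ∀ a b → (⊖ a) · b ≡ ⊖ (a · b)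
  neg-·ˡ a b = sym (-‿distribˡ-* a b)

  cancel-inverseˡ : ∀ {a a⁻¹} → a · a⁻¹ ≡ 𝟙 → ∀ b → a⁻¹ · (a · b) ≡ b
  cancel-inverseˡ {a} {a⁻¹} a·a⁻¹≡1 b = begin
    a⁻¹ · (a · b)    ≡⟨ *-assoc a⁻¹ a b ⟨
    (a⁻¹ · a) · b    ≡⟨ cong (_· b) (trans (*-comm a⁻¹ a) a·a⁻¹≡1) ⟩
    𝟙 · b            ≡⟨ *-identityˡ b ⟩
    b                ∎
    where open ≡-Reasoning

  cancel-inverseʳ : ∀ {a a⁻¹} → a · a⁻¹ ≡ 𝟙 → ∀ b → a · (a⁻¹ · b) ≡ b
  cancel-inverseʳ {a} {a⁻¹} a·a⁻¹≡1 = cancel-inverseˡ (trans (*-comm a⁻¹ a) a·a⁻¹≡1)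

  ·-nonzero : ∀ {a b} → a ≢ 𝟘 → b ≢ 𝟘 → a · b ≢ 𝟘
  ·-nonzero {a} {b} a≢0 b≢0 ab≡0 with inverse a a≢0
  ... | _ , a·a⁻¹≡1 = b≢0 (trans (sym (cancel-inverseˡ a·a⁻¹≡1 b)) (trans (cong (_ ·_) ab≡0) (zeroʳ _)))

  cross-cancel : ∀ a b → a · b ⊕ (⊖ b) · a ≡ 𝟘
  cross-cancel a b = trans (cong (a · b ⊕_) (trans (neg-·ˡ b a) (cong ⊖_ (*-comm b a)))) (-‿inverseʳ (a · b))

  ⊕-·𝟘 : ∀ a b → a ⊕ b · 𝟘 ≡ a
  ⊕-·𝟘 a b = trans (cong (a ⊕_) (zeroʳ b)) (+-identityʳ a)

  solve-proportional : ∀ {a a⁻¹ b x y} → a · a⁻¹ ≡ 𝟙 → a · y ⊕ (⊖ x) · b ≡ 𝟘 → y ≡ (b · a⁻¹) · x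
  solve-proportional {a} {a⁻¹} {b} {x} {y} a·a⁻¹≡1 combination≡0 = begin
    y                  ≡⟨ cancel-inverseˡ a·a⁻¹≡1 y ⟨
    a⁻¹ · (a · y)      ≡⟨ cong (a⁻¹ ·_) a·y≡x·b ⟩
    a⁻¹ · (x · b)      ≡⟨ solve 3 (λ a⁻¹ x b → a⁻¹ ⊗ (x ⊗ b) ⊜ (b ⊗ a⁻¹) ⊗ x) refl a⁻¹ x b ⟩
    (b · a⁻¹) · x      ∎
    where
    open ≡-Reasoning
    a·y≡x·b : a · y ≡ x · b
    a·y≡x·b = x∙y⁻¹≈ε⇒x≈y (a · y) (x · b) (trans (cong (a · y ⊕_) (sym (neg-·ˡ x b))) combination≡0)

  unit-product : ∀ {a a⁻¹ b b⁻¹} → a · a⁻¹ ≡ 𝟙 → b · b⁻¹ ≡ 𝟙 → (b · a⁻¹) · (a · b⁻¹) ≡ 𝟙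
  unit-product {a} {a⁻¹} {b} {b⁻¹} a·a⁻¹≡1 b·b⁻¹≡1 = begin
    (b · a⁻¹) · (a · b⁻¹)   ≡⟨ regroup a a⁻¹ b b⁻¹ ⟩
    (a · a⁻¹) · (b · b⁻¹)   ≡⟨ cong₂ _·_ a·a⁻¹≡1 b·b⁻¹≡1 ⟩
    𝟙 · 𝟙                   ≡⟨ *-identityˡ 𝟙 ⟩
    𝟙                       ∎
    where
    open ≡-Reasoning
    regroup : ∀ a a⁻¹ b b⁻¹ → (b · a⁻¹) · (a · b⁻¹) ≡ (a · a⁻¹) · (b · b⁻¹)
    regroup = solve 4 (λ a a⁻¹ b b⁻¹ → (b ⊗ a⁻¹) ⊗ (a ⊗ b⁻¹) ⊜ (a ⊗ a⁻¹) ⊗ (b ⊗ b⁻¹)) refl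

module Matroid {q : ℕ} (F : FiniteField q) {n : ℕ} (S : Vector F n → Set) (S-subspace : IsSubspace F S)
  where
  open FiniteField F
  open IsSubspace S-subspace
  open FieldFacts F
  open IsCommutativeRing isCommutativeRing using (zeroʳ; *-identityˡ)

  lookup-support : ∀ (x : Vector F n) k → lookup (support F x) k ≡ not (does (lookup x k ≟ 𝟘))
  lookup-support x k = lookup-map k _ x

  ∈-support⁺ : ∀ {x : Vector F n} {k} → lookup x k ≢ 𝟘 → k ∈ support F x
  ∈-support⁺ {x} {k} xk≢0 =
    lookup⇒[]= k (support F x) (trans (lookup-support x k) (cong not (dec-false (lookup x k ≟ 𝟘) xk≢0)))

  ∈-support⁻ : ∀ {x : Vector F n} {k} → k ∈ support F x → lookup x k ≢ 𝟘
  ∈-support⁻ {x} {k} k∈x xk≡0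
    with trans (sym ([]=⇒lookup k∈x)) (trans (lookup-support x k) (cong not (dec-true (_ ≟ 𝟘) xk≡0)))
  ... | ()

  independent-⊆ : ∀ {A B} → Independent F S B → A ⊆ B → Independent F S A
  independent-⊆ B-indep A⊆B C C-circuit C⊆A = B-indep C C-circuit (A⊆B ∘ C⊆A)

  ⊥-independent : Independent F S (Subset.⊥ {n})
  ⊥-independent C ((x , _ , x≢0 , refl) , _) C⊆⊥ =
    x≢0 (λ k → decidable-stable (lookup x k ≟ 𝟘) (λ xk≢0 → ∉⊥ (C⊆⊥ (∈-support⁺ xk≢0))))

  support-dependent : ∀ {y} → S y → ¬ IsZeroVec F y → ¬ Independent F S (support F y)
  support-dependent {y} = bounded (suc ∣ support F y ∣) (ℕ.n<1+n _)
    where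
    bounded : ∀ N {y} → ∣ support F y ∣ ℕ.< N → S y → ¬ IsZeroVec F y → ¬ Independent F S (support F y)
    bounded (suc N) {y} size<N y∈S y≢0 y-indep = ¬¬-excluded-middle cases
      where
      cases : Dec (∃[ D ] (IsSupport F S D × D ⊂ support F y)) → ⊥
      cases (yes (D , (z , z∈S , z≢0 , refl) , D⊂y)) =
        bounded N (ℕ.<-≤-trans (p⊂q⇒∣p∣<∣q∣ D⊂y) (ℕ.≤-pred size<N)) z∈S z≢0
          (independent-⊆ y-indep (proj₁ D⊂y))
      cases (no no-smaller) = y-indep (support F y) ((y , y∈S , y≢0 , refl) , minimal) id
        where
        minimal : ∀ D → IsSupport F S D → D ⊆ support F y → D ≡ support F y
        minimal D D-support D⊆y = ⊆-antisym D⊆y λ {k} k∈y →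
          decidable-stable (k ∈? D) (λ k∉D → no-smaller (D , D-support , D⊆y , k , k∈y , k∉D))

  lincomb : Carrier → Vector F n → Carrier → Vector F n → Vector F n
  lincomb a x b y = zipWith _⊕_ (map (a ·_) x) (map (b ·_) y)

  lookup-lincomb : ∀ a x b y k → lookup (lincomb a x b y) k ≡ a · lookup x k ⊕ b · lookup y k
  lookup-lincomb a x b y k =
    trans (lookup-zipWith _⊕_ k (map (a ·_) x) (map (b ·_) y))
          (cong₂ _⊕_ (lookup-map k (a ·_) x) (lookup-map k (b ·_) y))

  eliminate : Fin n → Vector F n → Vector F n → Vector F n
  eliminate l z y = lincomb (lookup z l) y (⊖ lookup y l) z

  eliminate∈S : ∀ l {z y} → S z → S y → S (eliminate l z y)
  eliminate∈S l z∈S y∈S = +-closed (·-closed _ y∈S) (·-closed _ z∈S)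

  eliminate-at : ∀ l z y → lookup (eliminate l z y) l ≡ 𝟘
  eliminate-at l z y = trans (lookup-lincomb _ y _ z l) (cross-cancel (lookup z l) (lookup y l))

  eliminate-elsewhere : ∀ l z y {k} → lookup z k ≡ 𝟘 → lookup (eliminate l z y) k ≡ lookup z l · lookup y k
  eliminate-elsewhere l z y {k} zk≡0 =
    trans (lookup-lincomb _ y _ z k)
          (trans (cong (λ t → lookup z l · lookup y k ⊕ ⊖ lookup y l · t) zk≡0) (⊕-·𝟘 _ _))

  InSpan : Subset n → Fin n → Set
  InSpan B k = ∃[ y ] (S y × lookup y k ≢ 𝟘 × (∀ l → l ≢ k → l ∉ B → lookup y l ≡ 𝟘))

  circuit⇒inSpan : ∀ {B C k} → Independent F S B → IsCircuit F S C → C ⊆ B ∪ ⁅ k ⁆ → InSpan B k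
  circuit⇒inSpan {B} {C} {k} B-indep C-circuit@((x , x∈S , _ , refl) , _) C⊆B∪k = x , x∈S , xk≢0 , outside
    where
    xk≢0 : lookup x k ≢ 𝟘
    xk≢0 xk≡0 = B-indep C C-circuit λ {l} l∈C →
      Sum.[ id , (λ l∈k → ⊥-elim (∈-support⁻ l∈C (subst (λ t → lookup x t ≡ 𝟘) (sym (x∈⁅y⁆⇒x≡y k l∈k)) xk≡0))) ]′
        (x∈p∪q⁻ B ⁅ k ⁆ (C⊆B∪k l∈C))
    outside : ∀ l → l ≢ k → l ∉ B → lookup x l ≡ 𝟘
    outside l l≢k l∉B = decidable-stable (lookup x l ≟ 𝟘) λ xl≢0 →
      Sum.[ l∉B , l≢k ∘ x∈⁅y⁆⇒x≡y k ]′ (x∈p∪q⁻ B ⁅ k ⁆ (C⊆B∪k (∈-support⁺ xl≢0)))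

  dependent⇒inSpan : ∀ {B k} → Independent F S B → ¬ Independent F S (B ∪ ⁅ k ⁆) → ¬ ¬ InSpan B k
  dependent⇒inSpan B-indep dependent ¬span = dependent λ C C-circuit C⊆ → ¬span (circuit⇒inSpan B-indep C-circuit C⊆)

  -- y′ arises from y by clearing, with vectors spanned by B, the coordinates in L outside B ∪ {k}.
  Reduced : Subset n → Fin n → Vector F n → List (Fin n) → Vector F n → Set
  Reduced B k y L y′ = S y′ × lookup y′ k ≢ 𝟘 ×
                       (∀ l → l ≢ k → l ∉ B → lookup y′ l ≢ 𝟘 → lookup y l ≢ 𝟘) ×
                       (∀ l → l ∈ˡ L → l ≢ k → l ∉ B → lookup y′ l ≡ 𝟘)

  reduced-keep : ∀ {B k y L y′ l} → Reduced B k y L y′ →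
    (l ≢ k → l ∉ B → lookup y′ l ≡ 𝟘) → Reduced B k y (l ∷ L) y′
  reduced-keep (y′∈S , y′k≢0 , y′⊆y , cleared) y′l≡0 = y′∈S , y′k≢0 , y′⊆y , λ where
    _ (here refl) → y′l≡0
    m (there m∈L) → cleared m m∈L

  reduced-eliminate : ∀ {B k y L y′ l} → k ∉ B → l ≢ k → Reduced B k y L y′ → InSpan B l →
    ∃ (Reduced B k y (l ∷ L))
  reduced-eliminate {B} {k} {y} {L} {y′} {l} k∉B l≢k
    (y′∈S , y′k≢0 , y′⊆y , cleared) (z , z∈S , zl≢0 , z-outside) =
    y″ , eliminate∈S l z∈S y′∈S , y″k≢0 , y″⊆y , cleared″
    where
    y″ : Vector F n
    y″ = eliminate l z y′
    y″-off : ∀ {m} → m ≢ l → m ∉ B → lookup y″ m ≡ lookup z l · lookup y′ m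
    y″-off m≢l m∉B = eliminate-elsewhere l z y′ (z-outside _ m≢l m∉B)
    y″k≢0 : lookup y″ k ≢ 𝟘
    y″k≢0 y″k≡0 = ·-nonzero zl≢0 y′k≢0 (trans (sym (y″-off (l≢k ∘ sym) k∉B)) y″k≡0)
    y″⊆y : ∀ m → m ≢ k → m ∉ B → lookup y″ m ≢ 𝟘 → lookup y m ≢ 𝟘
    y″⊆y m m≢k m∉B y″m≢0 with m Fin.≟ l
    ... | yes refl = ⊥-elim (y″m≢0 (eliminate-at l z y′))
    ... | no m≢l = y′⊆y m m≢k m∉B λ y′m≡0 →
            y″m≢0 (trans (y″-off m≢l m∉B) (trans (cong (lookup z l ·_) y′m≡0) (zeroʳ _)))
    cleared″ : ∀ m → m ∈ˡ l ∷ L → m ≢ k → m ∉ B → lookup y″ m ≡ 𝟘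
    cleared″ m m∈l∷L m≢k m∉B with m Fin.≟ l | m∈l∷L
    ... | yes refl | _ = eliminate-at l z y′
    ... | no m≢l | here m≡l = ⊥-elim (m≢l m≡l)
    ... | no m≢l | there m∈L =
            trans (y″-off m≢l m∉B) (trans (cong (lookup z l ·_) (cleared m m∈L m≢k m∉B)) (zeroʳ _))

  inSpan-trans : ∀ {B k y} → k ∉ B → S y → lookup y k ≢ 𝟘 →
    (∀ l → l ≢ k → l ∉ B → lookup y l ≢ 𝟘 → ¬ ¬ InSpan B l) → ¬ ¬ InSpan B k
  inSpan-trans {B} {k} {y} k∉B y∈S yk≢0 spanned = ¬¬-map finish (reduce (allFin n))
    where
    reduce : ∀ L → ¬ ¬ ∃ (Reduced B k y L)
    reduce [] = pure (y , y∈S , yk≢0 , (λ _ _ _ → id) , λ _ ())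
    reduce (l ∷ L) = reduce L >>= λ (y′ , reduced) → step reduced (l Fin.≟ k) (l ∈? B) (lookup y′ l ≟ 𝟘)
      where
      step : ∀ {y′} → Reduced B k y L y′ → Dec (l ≡ k) → Dec (l ∈ B) → Dec (lookup y′ l ≡ 𝟘) →
             ¬ ¬ ∃ (Reduced B k y (l ∷ L))
      step reduced (yes l≡k) _ _ = pure (_ , reduced-keep {y = y} reduced λ l≢k → ⊥-elim (l≢k l≡k))
      step reduced (no _) (yes l∈B) _ = pure (_ , reduced-keep {y = y} reduced λ _ l∉B → ⊥-elim (l∉B l∈B))
      step reduced (no _) (no _) (yes y′l≡0) = pure (_ , reduced-keep {y = y} reduced λ _ _ → y′l≡0)
      step reduced@(_ , _ , y′⊆y , _) (no l≢k) (no l∉B) (no y′l≢0) =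
        ¬¬-map (reduced-eliminate {y = y} k∉B l≢k reduced) (spanned l l≢k l∉B (y′⊆y l l≢k l∉B y′l≢0))

    finish : ∃ (Reduced B k y (allFin n)) → InSpan B k
    finish (y′ , y′∈S , y′k≢0 , _ , cleared) =
      y′ , y′∈S , y′k≢0 , λ l l≢k l∉B → cleared l (∈-allFin l) l≢k l∉B

  spanning⇒basis : ∀ {B} → Independent F S B → (∀ l → l ∉ B → ¬ ¬ InSpan B l) → IsBasis F S B
  spanning⇒basis {B} B-indep spanned = B-indep , λ I I-indep B⊆I → ⊆-antisym (I⊆B I-indep B⊆I) B⊆I
    where
    I⊆B : ∀ {I} → Independent F S I → B ⊆ I → I ⊆ B
    I⊆B {I} I-indep B⊆I {l} l∈I = decidable-stable (l ∈? B) λ l∉B → spanned l l∉B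
      λ (z , z∈S , zl≢0 , z-outside) → support-dependent z∈S (λ z≡0 → zl≢0 (z≡0 l))
        (independent-⊆ I-indep (support⊆I z-outside))
      where
      support⊆I : ∀ {z} → (∀ m → m ≢ l → m ∉ B → lookup z m ≡ 𝟘) → support F z ⊆ I
      support⊆I z-outside {m} m∈z with m Fin.≟ l | m ∈? B
      ... | yes refl | _ = l∈I
      ... | no _ | yes m∈B = B⊆I m∈B
      ... | no m≢l | no m∉B = ⊥-elim (∈-support⁻ m∈z (z-outside m m≢l m∉B))

  MaximalIndependentIn : Subset n → List (Fin n) → Subset n → Set
  MaximalIndependentIn A L B =
    B ⊆ A × Independent F S B × (∀ l → l ∈ˡ L → l ∈ A → l ∉ B → ¬ Independent F S (B ∪ ⁅ l ⁆))

  maximal-independent : ∀ A L → ¬ ¬ ∃ (MaximalIndependentIn A L)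
  maximal-independent A [] = pure empty
    where
    empty : ∃ (MaximalIndependentIn A [])
    empty = Subset.⊥ , ⊥⊆ , ⊥-independent , λ _ ()
  maximal-independent A (l ∷ L) = maximal-independent A L >>= grow
    where
    grow : ∃ (MaximalIndependentIn A L) → ¬ ¬ ∃ (MaximalIndependentIn A (l ∷ L))
    grow (B , B⊆A , B-indep , saturated) = extend (l ∈? A) (l ∈? B)
      where
      keep : (l ∈ A → l ∉ B → ¬ Independent F S (B ∪ ⁅ l ⁆)) → ∃ (MaximalIndependentIn A (l ∷ L))
      keep l-saturated = B , B⊆A , B-indep , λ where
        _ (here refl) → l-saturated
        m (there m∈L) → saturated m m∈L

      add : l ∈ A → Independent F S (B ∪ ⁅ l ⁆) → ∃ (MaximalIndependentIn A (l ∷ L))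
      add l∈A B∪l-indep = B ∪ ⁅ l ⁆ , B∪l⊆A , B∪l-indep , λ where
          _ (here refl) _ l∉B∪l → ⊥-elim (l∉B∪l (q⊆p∪q B ⁅ l ⁆ (x∈⁅x⁆ l)))
          m (there m∈L) m∈A m∉B∪l indep →
            saturated m m∈L m∈A (m∉B∪l ∘ p⊆p∪q ⁅ l ⁆) (independent-⊆ indep (grow-⊆ m))
        where
        B∪l⊆A : B ∪ ⁅ l ⁆ ⊆ A
        B∪l⊆A k∈ = Sum.[ B⊆A , (λ k∈l → subst (_∈ A) (sym (x∈⁅y⁆⇒x≡y l k∈l)) l∈A) ]′ (x∈p∪q⁻ B ⁅ l ⁆ k∈)
        grow-⊆ : ∀ m → B ∪ ⁅ m ⁆ ⊆ (B ∪ ⁅ l ⁆) ∪ ⁅ m ⁆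
        grow-⊆ m k∈ = Sum.[ p⊆p∪q ⁅ m ⁆ ∘ p⊆p∪q ⁅ l ⁆ , q⊆p∪q (B ∪ ⁅ l ⁆) ⁅ m ⁆ ]′ (x∈p∪q⁻ B ⁅ m ⁆ k∈)

      add-or-keep : l ∈ A → Dec (Independent F S (B ∪ ⁅ l ⁆)) → ∃ (MaximalIndependentIn A (l ∷ L))
      add-or-keep l∈A (yes B∪l-indep) = add l∈A B∪l-indep
      add-or-keep l∈A (no dependent) = keep λ _ _ → dependent

      extend : Dec (l ∈ A) → Dec (l ∈ B) → ¬ ¬ ∃ (MaximalIndependentIn A (l ∷ L))
      extend (no l∉A) _ = pure (keep λ l∈A → ⊥-elim (l∉A l∈A))
      extend (yes _) (yes l∈B) = pure (keep λ _ l∉B → ⊥-elim (l∉B l∈B))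
      extend (yes l∈A) (no _) = ¬¬-map (add-or-keep l∈A) ¬¬-excluded-middle

  basis-avoiding : ∀ {i j x y} → S x → lookup x i ≢ 𝟘 → lookup x j ≡ 𝟘 → S y → lookup y j ≢ 𝟘 →
    ¬ ¬ (∃[ B ] (IsBasis F S B × i ∉ B × j ∉ B))
  basis-avoiding {i} {j} {x} {y} x∈S xi≢0 xj≡0 y∈S yj≢0 = ¬¬-map extend (maximal-independent A (allFin n))
    where
    A : Subset n
    A = ∁ (⁅ i ⁆ ∪ ⁅ j ⁆)
    ∈A : ∀ {l} → l ≢ i → l ≢ j → l ∈ A
    ∈A l≢i l≢j = x∉p⇒x∈∁p (Sum.[ l≢i ∘ x∈⁅y⁆⇒x≡y i , l≢j ∘ x∈⁅y⁆⇒x≡y j ]′ ∘ x∈p∪q⁻ ⁅ i ⁆ ⁅ j ⁆)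
    i∉A : i ∉ A
    i∉A i∈A = x∈∁p⇒x∉p i∈A (p⊆p∪q ⁅ j ⁆ (x∈⁅x⁆ i))
    j∉A : j ∉ A
    j∉A j∈A = x∈∁p⇒x∉p j∈A (q⊆p∪q ⁅ i ⁆ ⁅ j ⁆ (x∈⁅x⁆ j))

    extend : ∃ (MaximalIndependentIn A (allFin n)) → ∃[ B ] (IsBasis F S B × i ∉ B × j ∉ B)
    extend (B , B⊆A , B-indep , saturated) = B , spanning⇒basis B-indep spans , i∉A ∘ B⊆A , j∉A ∘ B⊆A
      where
      spans-A : ∀ {l} → l ≢ i → l ≢ j → l ∉ B → ¬ ¬ InSpan B l
      spans-A {l} l≢i l≢j l∉B = dependent⇒inSpan B-indep (saturated l (∈-allFin l) (∈A l≢i l≢j) l∉B)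
      spans-i : ¬ ¬ InSpan B i
      spans-i = inSpan-trans (i∉A ∘ B⊆A) x∈S xi≢0 λ l l≢i l∉B xl≢0 →
        spans-A l≢i (λ l≡j → xl≢0 (subst (λ t → lookup x t ≡ 𝟘) (sym l≡j) xj≡0)) l∉B
      spans-j : ¬ ¬ InSpan B j
      spans-j = inSpan-trans (j∉A ∘ B⊆A) y∈S yj≢0 λ l l≢j l∉B _ → case-i l l≢j l∉B (l Fin.≟ i)
        where
        case-i : ∀ l → l ≢ j → l ∉ B → Dec (l ≡ i) → ¬ ¬ InSpan B l
        case-i _ _ _ (yes refl) = spans-i
        case-i _ l≢j l∉B (no l≢i) = spans-A l≢i l≢j l∉B
      spans : ∀ l → l ∉ B → ¬ ¬ InSpan B l
      spans l l∉B with l Fin.≟ i | l Fin.≟ j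
      ... | yes refl | _ = spans-i
      ... | no _ | yes refl = spans-j
      ... | no l≢i | no l≢j = spans-A l≢i l≢j l∉B

  series⇒nonzero : ∀ {i j x} → InSeries F S i j → S x → lookup x i ≢ 𝟘 → lookup x j ≢ 𝟘
  series⇒nonzero {i} {j} {x} (i≢j , meets , minimal) x∈S xi≢0 xj≡0 = i≢j (x∈⁅y⁆⇒x≡y j i∈⁅j⁆)
    where
    j-meets : MeetsAllBases F S ⁅ j ⁆
    j-meets B (B-indep , B-maximal) with j ∈? B
    ... | yes j∈B = j , x∈⁅x⁆ j , j∈B
    ... | no j∉B = ⊥-elim (dependent⇒inSpan B-indep B∪j-dependent λ (y , y∈S , yj≢0 , _) →
                     basis-avoiding x∈S xi≢0 xj≡0 y∈S yj≢0 λ (B′ , B′-basis , i∉B′ , j∉B′) →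
                       misses i∉B′ j∉B′ (meets B′ B′-basis))
      where
      B∪j-dependent : ¬ Independent F S (B ∪ ⁅ j ⁆)
      B∪j-dependent indep = j∉B (subst (j ∈_) (B-maximal _ indep (p⊆p∪q ⁅ j ⁆)) (q⊆p∪q B ⁅ j ⁆ (x∈⁅x⁆ j)))
      misses : ∀ {B′} → i ∉ B′ → j ∉ B′ → ¬ Meets F S (⁅ i ⁆ ∪ ⁅ j ⁆) B′
      misses {B′} i∉B′ j∉B′ (k , k∈ij , k∈B′) =
        Sum.[ (λ k∈i → i∉B′ (subst (_∈ B′) (x∈⁅y⁆⇒x≡y i k∈i) k∈B′)) ,
              (λ k∈j → j∉B′ (subst (_∈ B′) (x∈⁅y⁆⇒x≡y j k∈j) k∈B′)) ]′
          (x∈p∪q⁻ ⁅ i ⁆ ⁅ j ⁆ k∈ij)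
    i∈⁅j⁆ : i ∈ ⁅ j ⁆
    i∈⁅j⁆ = subst (i ∈_) (sym (minimal ⁅ j ⁆ j-meets (q⊆p∪q ⁅ i ⁆ ⁅ j ⁆))) (p⊆p∪q ⁅ j ⁆ (x∈⁅x⁆ i))

  series-sym : ∀ {i j} → InSeries F S i j → InSeries F S j i
  series-sym {i} {j} (i≢j , cocircuit) = i≢j ∘ sym , subst (IsCocircuit F S) (∪-comm ⁅ i ⁆ ⁅ j ⁆) cocircuit

  Proportional : Fin n → Fin n → Set
  Proportional i j = ∃₂ λ c c⁻¹ → c · c⁻¹ ≡ 𝟙 × ∀ x → S x → lookup x j ≡ c · lookup x i

  series-proportional : ∀ {i j} → InSeries F S i j → ¬ ¬ Proportional i j
  series-proportional {i} {j} series = ¬¬-map proportional ¬¬-excluded-middle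
    where
    zero-i⇒zero-j : ∀ {x} → S x → lookup x i ≡ 𝟘 → lookup x j ≡ 𝟘
    zero-i⇒zero-j {x} x∈S xi≡0 =
      decidable-stable (lookup x j ≟ 𝟘) (λ xj≢0 → series⇒nonzero (series-sym series) x∈S xj≢0 xi≡0)

    proportional : Dec (∃[ x ] (S x × lookup x i ≢ 𝟘)) → Proportional i j
    proportional (no ¬witness) = 𝟙 , 𝟙 , *-identityˡ 𝟙 , λ x x∈S →
      let xi≡0 = decidable-stable (lookup x i ≟ 𝟘) (λ xi≢0 → ¬witness (x , x∈S , xi≢0))
      in trans (zero-i⇒zero-j x∈S xi≡0) (sym (trans (cong (𝟙 ·_) xi≡0) (*-identityˡ 𝟘)))
    proportional (yes (x₀ , x₀∈S , a≢0))
      with inverse (lookup x₀ i) a≢0 | inverse (lookup x₀ j) (series⇒nonzero series x₀∈S a≢0)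
    ... | a⁻¹ , a·a⁻¹≡1 | b⁻¹ , b·b⁻¹≡1 =
      lookup x₀ j · a⁻¹ , lookup x₀ i · b⁻¹ , unit-product a·a⁻¹≡1 b·b⁻¹≡1 , λ y y∈S →
        solve-proportional a·a⁻¹≡1
          (trans (sym (lookup-lincomb _ y _ x₀ j))
                 (zero-i⇒zero-j (eliminate∈S i x₀∈S y∈S) (eliminate-at i x₀ y)))

lemma7p2 : (q : ℕ) → IsPrimePower q → (F : FiniteField q) →
    (m : ℕ) → (S : Vector F (suc m) → Set) → IsSubspace F S →
    (i j : Fin (suc m)) → InSeries F S i j →
    MultIdeal F S ⇔ MultIdeal F (dropCoord F j S)
lemma7p2 q _ F m S S-subspace i j series = mk⇔
  (λ ideal → multIdeal-stable (¬¬-map (λ prop → Equivalence.to (merge prop) ideal) proportional))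
  (λ ideal′ → multIdeal-stable (¬¬-map (λ prop → Equivalence.from (merge prop) ideal′) proportional))
  where
  open FiniteField F using (_·_)
  open FieldFacts F using (cancel-inverseˡ; cancel-inverseʳ)
  open Polyhedron F using (multIdeal-stable)
  open Matroid F S S-subspace using (Proportional; series-proportional)

  proportional : ¬ ¬ Proportional i j
  proportional = series-proportional series

  j≢i : j ≢ i
  j≢i = proj₁ series ∘ sym

  merge : Proportional i j → MultIdeal F S ⇔ MultIdeal F (dropCoord F j S)
  merge (c , c⁻¹ , c·c⁻¹≡1 , xj≡c·xi) =
    Merge.ideal⇔ F S j (punchOut j≢i) (c ·_) (c⁻¹ ·_) (cancel-inverseˡ c·c⁻¹≡1) (cancel-inverseʳ c·c⁻¹≡1)
      (λ x x∈S → subst (λ k → lookup x j ≡ c · lookup x k) (sym (punchIn-punchOut j≢i)) (xj≡c·xi x x∈S))
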